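{- Let $G = (V,E)$ be a finite undirected graph with a total order on $V$, and let $\Sigma_G$ be its clique complex. Consider the following serial procedure, which builds layers $D(0), D(1), \dots$ of a directed tree whose nodes are simplices (subsets of $V$). Initialization: $D(0)$ consists of one node $\{v\}$ for each $v \in V$; $D(1)$ consists of one node $\{u,v\}$ for each edge $\{u,v\}\in E$, and each edge node is connected to the node of its smaller vertex. Inductive step (for $k \geq 1$, given layers $D(0),\dots,D(k)$ in which an element $\rho \in D(k-1)$ is connected to an element $\sigma \in D(k)$ iff $\rho$ is the lexicographically minimal $(k-1)$-face of $\sigma$): for each $\rho \in D(k-1)$, let $L_\rho \subset D(k)$ be the list of elements of $D(k)$ connected to $\rho$. For every pair $(\sigma_0 < \sigma_1)$ of distinct elements of $L_\rho$ (ordered lexicographically by their increasingly ordered vertex lists), let $v_i$ be the unique element of $(\sigma_0 \cup \sigma_1) \setminus \sigma_i$ for $i=0,1$, and check whether $\{v_0, v_1\} \in E$; if so, add $\tau := \sigma_0 \cup \sigma_1$ to $D(k+1)$ and connect $\sigma_0$ to $\tau$. This is repeated until a layer is empty. Consider also the parallel version of this procedure, in which the same edge checks are performed, independently and concurrently, with the construction of $D(k+1)$ from pairs in $L_\rho$ beginning as soon as two simplices in $D(k)$ sharing the common $(k-1)$-face $\rho$ are available. Then both the serial and the parallel procedures construct the clique complex of $G$: the set of all simplices appearing as nodes in the layers $D(0), D(1), \dots$ is exactly the set of simplices of $\Sigma_G$.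
   Context: The clique complex (Vietoris–Rips complex) $\Sigma_G$ of an undirected graph $G=(V,E)$ is the abstract simplicial complex whose simplices are the nonempty sets $\sigma=\{v_0,\dots,v_m\}\subset V$ such that $\{v_i,v_j\}\in E$ for all $i\neq j$; such a $\sigma$ is an $m$-simplex, and a $j$-face of a simplex is a subset with $j+1$ elements. Simplices of the same dimension are ordered lexicographically by their increasingly ordered vertex lists. -}

module Defs where

open import Data.Nat using (ℕ; zero; suc)
open import Data.Bool using (Bool; true; false; if_then_else_; _∧_; not)
open import Data.Fin as F using (Fin; toℕ)
open import Data.Nat using (_<ᵇ_; _≡ᵇ_)
open import Data.List using (List; []; _∷_; map; concatMap; filterᵇ; allFin)
open import Data.List.Properties using (≡-dec)
open import Data.List.Membership.Propositional using (_∈_)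
open import Data.List.Relation.Unary.Linked using (Linked)
open import Data.Product using (_×_; _,_; proj₁; proj₂)
open import Relation.Nullary using (¬_; does)
open import Relation.Binary using (Decidable)
open import Relation.Binary.PropositionalEquality using (_≡_; _≢_)

-- A finite undirected graph on the vertex set V = Fin n, totally ordered
-- by the natural order of Fin n.  Adjacency is a symmetric decidable
-- relation (loops, if any, play no role anywhere below).

record Graph (n : ℕ) : Set₁ where
  field
    Adj  : Fin n → Fin n → Set
    sym  : ∀ {u v} → Adj u v → Adj v u
    adj? : Decidable Adj

open Graph public

-- Simplices are finite subsets of V, represented canonically as their
-- increasingly ordered vertex lists.

Simplex : ℕ → Set
Simplex n = List (Fin n)

IsCliqueSimplex : ∀ {n} → Graph n → Simplex n → Set
IsCliqueSimplex G σ =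
  (σ ≢ []) × Linked F._<_ σ ×
  (∀ {u v} → u ∈ σ → v ∈ σ → u ≢ v → Adj G u v)

_<V_ : ∀ {n} → Fin n → Fin n → Bool
x <V y = toℕ x <ᵇ toℕ y

_=V_ : ∀ {n} → Fin n → Fin n → Bool
x =V y = toℕ x ≡ᵇ toℕ y

lexLt : ∀ {n} → Simplex n → Simplex n → Bool
lexLt []       []       = false
lexLt []       (_ ∷ _)  = true
lexLt (_ ∷ _)  []       = false
lexLt (x ∷ xs) (y ∷ ys) =
  if x <V y then true else (if x =V y then lexLt xs ys else false)

union : ∀ {n} → Simplex n → Simplex n → Simplex n
union []       ys       = ys
union (x ∷ xs) []       = x ∷ xs
union (x ∷ xs) (y ∷ ys) =
  if x <V y then x ∷ union xs (y ∷ ys)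
  else (if x =V y then x ∷ union xs ys else y ∷ union (x ∷ xs) ys)

elemV : ∀ {n} → Fin n → Simplex n → Bool
elemV x []       = false
elemV x (y ∷ ys) = if x =V y then true else elemV x ys

diff : ∀ {n} → Simplex n → Simplex n → Simplex n
diff xs ys = filterᵇ (λ x → not (elemV x ys)) xs

_=S_ : ∀ {n} → Simplex n → Simplex n → Bool
σ =S τ = does (≡-dec F._≟_ σ τ)

edgeCheck : ∀ {n} → Graph n → Simplex n → Simplex n → Bool
edgeCheck G σ₀ σ₁ with diff (union σ₀ σ₁) σ₀ | diff (union σ₀ σ₁) σ₁
... | v₀ ∷ [] | v₁ ∷ [] = does (adj? G v₀ v₁)
... | _       | _       = false

-- The serial procedure.  A node of the tree is a pair
-- (simplex , parent simplex); nodes of D(0) have parent [] (no parent).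

Node : ℕ → Set
Node n = Simplex n × Simplex n

D0 : ∀ {n} → List (Node n)
D0 {n} = map (λ v → (v ∷ []) , []) (allFin n)

D1 : ∀ {n} → Graph n → List (Node n)
D1 {n} G = concatMap (λ u → concatMap (λ v →
    if (u <V v) ∧ does (adj? G u v)
    then ((u ∷ v ∷ []) , (u ∷ [])) ∷ [] else []) (allFin n)) (allFin n)

step : ∀ {n} → Graph n → List (Node n) → List (Node n) → List (Node n)
step G Dk-1 Dk = concatMap forRho Dk-1
  where
  forRho : _ → _
  forRho ρn =
    let L = map proj₁ (filterᵇ (λ s → proj₂ s =S proj₁ ρn) Dk) in
    concatMap (λ σ₀ → concatMap (λ σ₁ →
      if lexLt σ₀ σ₁ ∧ edgeCheck G σ₀ σ₁
      then (union σ₀ σ₁ , σ₀) ∷ [] else []) L) L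

-- layers k = (D(k) , D(k+1))
layers : ∀ {n} → Graph n → ℕ → List (Node n) × List (Node n)
layers G zero    = D0 , D1 G
layers G (suc k) = let p = layers G k in proj₂ p , step G (proj₁ p) (proj₂ p)

D : ∀ {n} → Graph n → ℕ → List (Node n)
D G k = proj₁ (layers G k)

-- The parallel procedure: the same edge checks performed in any order /
-- concurrently.  Its output is the set of nodes generated by the rules
-- below, independently of scheduling.

data PNode {n} (G : Graph n) : ℕ → Simplex n → Simplex n → Set where
  vertex : (v : Fin n) → PNode G 0 (v ∷ []) []
  edge   : (u v : Fin n) → (u <V v) ≡ true → Adj G u v →
           PNode G 1 (u ∷ v ∷ []) (u ∷ [])
  join   : ∀ {k ρ ρ' σ₀ σ₁} → PNode G k ρ ρ' →
           PNode G (suc k) σ₀ ρ → PNode G (suc k) σ₁ ρ →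
           lexLt σ₀ σ₁ ≡ true → edgeCheck G σ₀ σ₁ ≡ true →
           PNode G (suc (suc k)) (union σ₀ σ₁) σ₀

-- A clique with at least three vertices, listed increasingly as π ∷ʳ a ∷ʳ x, is
-- the union of its faces π ∷ʳ a and π ∷ʳ x, which both hang below their common
-- minimal face π; for this pair the edge check asks exactly whether {x , a} is an
-- edge, which holds in a clique.  Induction on the dimension therefore builds
-- every clique, attached to its minimal face π ∷ʳ a.  Conversely the union of two
-- cliques σ₀, σ₁ with (σ₀ ∪ σ₁) ∖ σᵢ = {vᵢ} and {v₀ , v₁} an edge is a clique, so
-- nothing else is built.  The serial layers contain exactly the nodes derivable
-- by the rules of the parallel procedure, since both apply the same rules.

module Submission where

open import Defs
open import Data.Nat using (ℕ; zero; suc)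
open import Data.Nat.Properties using (<ᵇ-reflects-<; ≡ᵇ⇒≡; ≡⇒≡ᵇ; ≮⇒≥)
open import Data.Bool using (true; false; if_then_else_; _∧_; not; T)
open import Data.Bool.Properties using (T-≡; T-not-≡)
open import Data.Unit using (tt)
open import Data.Empty using (⊥-elim)
open import Data.Sum using (_⊎_; inj₁; inj₂)
import Data.Sum as Sum
open import Data.Product using (_×_; _,_; proj₁; proj₂; ∃-syntax)
open import Data.Fin as F using (Fin; toℕ)
open import Data.Fin.Properties using (toℕ-injective; <-irrefl; <-trans; ≤∧≢⇒<; <⇒≢)
open import Data.List using (List; []; _∷_; _++_; _∷ʳ_; map; filterᵇ; allFin)
open import Data.List.Properties using (≡-dec; filter-++; filter-none; filter-accept)
open import Data.List.Reverse using (Reverse; []; _∶_∶ʳ_; reverseView)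
open import Data.List.Membership.Propositional using (_∈_; _∉_; find; lose)
open import Data.List.Membership.Propositional.Properties
  using (∈-map⁺; ∈-map⁻; ∈-++⁺ˡ; ∈-++⁺ʳ; ∈-concatMap⁺; ∈-concatMap⁻; ∈-filter⁺; ∈-filter⁻; ∈-allFin)
open import Data.List.Relation.Binary.Subset.Propositional using (_⊆_)
open import Data.List.Relation.Binary.Subset.Propositional.Properties using (⊆-refl; ⊆-trans; xs⊆xs++ys; ++⁺)
open import Data.List.Relation.Unary.Any using (here; there; satisfied)
open import Data.List.Relation.Unary.All as All using (All; []; _∷_)
import Data.List.Relation.Unary.All.Properties as All
open import Data.List.Relation.Unary.All.Properties using (All¬⇒¬Any)
open import Data.List.Relation.Unary.AllPairs using (AllPairs; []; _∷_)
import Data.List.Relation.Unary.AllPairs.Properties as AllPairs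
open import Data.List.Relation.Unary.Linked using (Linked; [-]; _∷_)
open import Data.List.Relation.Unary.Linked.Properties using (AllPairs⇒Linked; Linked⇒AllPairs)
open import Function using (_∘_)
open import Function.Bundles using (_⇔_; mk⇔; Equivalence)
import Function.Properties.Equivalence as ⇔
open import Relation.Binary using (Rel)
open import Relation.Nullary using (¬_; Dec; yes; does; _because_)
open import Relation.Nullary.Decidable using (T?; dec-true)
open import Relation.Nullary.Reflects using (Reflects; ofʸ; ofⁿ; invert; fromEquivalence; det)
open import Relation.Binary.PropositionalEquality as ≡ using (_≡_; _≢_; refl; cong; cong₂; subst)
open ≡.≡-Reasoning

module _ {a r} {A : Set a} {R : Rel A r} where

  AllPairs-∷ʳ⁺ : ∀ {xs y} → AllPairs R xs → All (λ x → R x y) xs → AllPairs R (xs ∷ʳ y)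
  AllPairs-∷ʳ⁺ rxs rxy = AllPairs.++⁺ rxs ([] ∷ []) (All.map (_∷ []) rxy)

  AllPairs-∷ʳ⁻ : ∀ {xs y} → AllPairs R (xs ∷ʳ y) → AllPairs R xs × All (λ x → R x y) xs
  AllPairs-∷ʳ⁻ {[]}     _            = [] , []
  AllPairs-∷ʳ⁻ {x ∷ xs} (rx ∷ rxs) with AllPairs-∷ʳ⁻ rxs
  ... | rxs′ , rxsy = (All.++⁻ˡ xs rx ∷ rxs′) , (proj₂ (All.∷ʳ⁻ rx) ∷ rxsy)

module _ {a} {A : Set a} where

  ∷ʳ≢[] : ∀ (xs : List A) {x} → xs ∷ʳ x ≢ []
  ∷ʳ≢[] []      ()
  ∷ʳ≢[] (_ ∷ _) ()

  ∈-if⁺ : ∀ {b} {z : A} → T b → z ∈ (if b then z ∷ [] else [])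
  ∈-if⁺ {true} _ = here refl

  ∈-if⁻ : ∀ b {y z : A} → y ∈ (if b then z ∷ [] else []) → T b × y ≡ z
  ∈-if⁻ true (here y≡z) = tt , y≡z

T-∧-≡ : ∀ {b c} → T (b ∧ c) ⇔ (b ≡ true × c ≡ true)
T-∧-≡ {true}  {true}  = mk⇔ (λ _ → refl , refl) (λ _ → tt)
T-∧-≡ {true}  {false} = mk⇔ (λ ()) (λ ())
T-∧-≡ {false}         = mk⇔ (λ ()) (λ ())

module _ {p} {P : Set p} where

  T-does⁺ : ∀ (p? : Dec P) → P → T (does p?)
  T-does⁺ p? x = Equivalence.from T-≡ (dec-true p? x)

  T-does⁻ : ∀ (p? : Dec P) → T (does p?) → P
  T-does⁻ (true because [p]) _ = invert [p]

module _ {n : ℕ} where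

  Sorted : Simplex n → Set
  Sorted = AllPairs F._<_

  <V-reflects : ∀ (x y : Fin n) → Reflects (x F.< y) (x <V y)
  <V-reflects x y = <ᵇ-reflects-< (toℕ x) (toℕ y)

  =V-reflects : ∀ (x y : Fin n) → Reflects (x ≡ y) (x =V y)
  =V-reflects x y = fromEquivalence (toℕ-injective ∘ ≡ᵇ⇒≡ _ _) (≡⇒≡ᵇ _ _ ∘ cong toℕ)

  <⇒<V : ∀ {x y : Fin n} → x F.< y → (x <V y) ≡ true
  <⇒<V x<y = det (<V-reflects _ _) (ofʸ x<y)

  <V⇒< : ∀ {x y : Fin n} → (x <V y) ≡ true → x F.< y
  <V⇒< {x} {y} x<Vy = invert (subst (Reflects _) x<Vy (<V-reflects x y))

  <V-irrefl : ∀ (x : Fin n) → (x <V x) ≡ false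
  <V-irrefl x = det (<V-reflects x x) (ofⁿ (<-irrefl refl))

  =V-refl : ∀ (x : Fin n) → (x =V x) ≡ true
  =V-refl x = det (=V-reflects x x) (ofʸ refl)

  elemV-reflects : ∀ (x : Fin n) ys → Reflects (x ∈ ys) (elemV x ys)
  elemV-reflects x []       = ofⁿ λ ()
  elemV-reflects x (y ∷ ys) with x =V y | =V-reflects x y
  ... | true  | ofʸ x≡y = ofʸ (here x≡y)
  ... | false | ofⁿ x≢y with elemV x ys | elemV-reflects x ys
  ...   | true  | ofʸ x∈ys = ofʸ (there x∈ys)
  ...   | false | ofⁿ x∉ys = ofⁿ λ { (here x≡y) → x≢y x≡y ; (there x∈ys) → x∉ys x∈ys }

  outside? : ∀ (ys : Simplex n) x → Dec (T (not (elemV x ys)))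
  outside? ys x = T? (not (elemV x ys))

  ∉⇒outside : ∀ {z : Fin n} {ys} → z ∉ ys → T (not (elemV z ys))
  ∉⇒outside {z} {ys} z∉ys = Equivalence.from T-not-≡ (det (elemV-reflects z ys) (ofⁿ z∉ys))

  ∈⇒¬outside : ∀ {z : Fin n} {ys} → z ∈ ys → ¬ T (not (elemV z ys))
  ∈⇒¬outside {z} {ys} z∈ys = subst (T ∘ not) (det (elemV-reflects z ys) (ofʸ z∈ys))

  ∈-diff⁺ : ∀ {z : Fin n} {xs ys} → z ∈ xs → z ∉ ys → z ∈ diff xs ys
  ∈-diff⁺ {ys = ys} z∈xs z∉ys = ∈-filter⁺ (outside? ys) z∈xs (∉⇒outside z∉ys)

  diff-++ : ∀ (xs zs ys : Simplex n) → diff (xs ++ zs) ys ≡ diff xs ys ++ diff zs ys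
  diff-++ xs zs ys = filter-++ (outside? ys) xs zs

  diff-⊆ : ∀ {xs ys : Simplex n} → xs ⊆ ys → diff xs ys ≡ []
  diff-⊆ {ys = ys} xs⊆ys = filter-none (outside? ys) (All.tabulate (∈⇒¬outside ∘ xs⊆ys))

  diff-[∉] : ∀ {z : Fin n} {ys} → z ∉ ys → diff (z ∷ []) ys ≡ z ∷ []
  diff-[∉] {ys = ys} z∉ys = filter-accept (outside? ys) (∉⇒outside z∉ys)

  diff≡[v]⇒⊆ : ∀ {xs ys : Simplex n} {v} → diff xs ys ≡ v ∷ [] → xs ⊆ v ∷ ys
  diff≡[v]⇒⊆ {ys = ys} eq {z} z∈xs with elemV z ys | elemV-reflects z ys
  ... | true  | ofʸ z∈ys = there z∈ys
  ... | false | ofⁿ z∉ys with subst (z ∈_) eq (∈-diff⁺ z∈xs z∉ys)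
  ...   | here z≡v = here z≡v

  data UnionView (x y : Fin n) (xs ys : Simplex n) : Simplex n → Set where
    union< : x F.< y → UnionView x y xs ys (x ∷ union xs (y ∷ ys))
    union≡ : x ≡ y   → UnionView x y xs ys (x ∷ union xs ys)
    union> : y F.< x → UnionView x y xs ys (y ∷ union (x ∷ xs) ys)

  unionView : ∀ x y xs ys → UnionView x y xs ys (union (x ∷ xs) (y ∷ ys))
  unionView x y xs ys with x <V y | <V-reflects x y
  ... | true  | ofʸ x<y = union< x<y
  ... | false | ofⁿ x≮y with x =V y | =V-reflects x y
  ...   | true  | ofʸ x≡y = union≡ x≡y
  ...   | false | ofⁿ x≢y = union> (≤∧≢⇒< (≮⇒≥ x≮y) (x≢y ∘ ≡.sym))

  ∈-union⁻ : ∀ {z} xs ys → z ∈ union xs ys → z ∈ xs ⊎ z ∈ ys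
  ∈-union⁻ []       ys       z∈ = inj₂ z∈
  ∈-union⁻ (x ∷ xs) []       z∈ = inj₁ z∈
  ∈-union⁻ (x ∷ xs) (y ∷ ys) z∈ with union (x ∷ xs) (y ∷ ys) | unionView x y xs ys | z∈
  ... | _ | union< _ | here z≡x = inj₁ (here z≡x)
  ... | _ | union< _ | there z∈ = Sum.map₁ there (∈-union⁻ xs (y ∷ ys) z∈)
  ... | _ | union≡ _ | here z≡x = inj₁ (here z≡x)
  ... | _ | union≡ _ | there z∈ = Sum.map there there (∈-union⁻ xs ys z∈)
  ... | _ | union> _ | here z≡y = inj₂ (here z≡y)
  ... | _ | union> _ | there z∈ = Sum.map₂ there (∈-union⁻ (x ∷ xs) ys z∈)

  ∈-union⁺ˡ : ∀ {z} xs ys → z ∈ xs → z ∈ union xs ys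
  ∈-union⁺ˡ (x ∷ xs) []       z∈ = z∈
  ∈-union⁺ˡ (x ∷ xs) (y ∷ ys) z∈ with union (x ∷ xs) (y ∷ ys) | unionView x y xs ys | z∈
  ... | _ | union< _ | here z≡x = here z≡x
  ... | _ | union< _ | there z∈ = there (∈-union⁺ˡ xs (y ∷ ys) z∈)
  ... | _ | union≡ _ | here z≡x = here z≡x
  ... | _ | union≡ _ | there z∈ = there (∈-union⁺ˡ xs ys z∈)
  ... | _ | union> _ | z∈       = there (∈-union⁺ˡ (x ∷ xs) ys z∈)

  ∈-union⁺ʳ : ∀ {z} xs ys → z ∈ ys → z ∈ union xs ys
  ∈-union⁺ʳ []       ys       z∈ = z∈
  ∈-union⁺ʳ (x ∷ xs) (y ∷ ys) z∈ with union (x ∷ xs) (y ∷ ys) | unionView x y xs ys | z∈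
  ... | _ | union< _    | z∈       = there (∈-union⁺ʳ xs (y ∷ ys) z∈)
  ... | _ | union≡ refl | here z≡y = here z≡y
  ... | _ | union≡ refl | there z∈ = there (∈-union⁺ʳ xs ys z∈)
  ... | _ | union> _    | here z≡y = here z≡y
  ... | _ | union> _    | there z∈ = there (∈-union⁺ʳ (x ∷ xs) ys z∈)

  All-union : ∀ {p} {P : Fin n → Set p} {xs ys} → All P xs → All P ys → All P (union xs ys)
  All-union {xs = xs} {ys} pxs pys =
    All.tabulate (Sum.[ All.lookup pxs , All.lookup pys ] ∘ ∈-union⁻ xs ys)

  union-sorted : ∀ xs ys → Sorted xs → Sorted ys → Sorted (union xs ys)
  union-sorted []       ys       _ sys = sys
  union-sorted (x ∷ xs) []       sxs _ = sxs
  union-sorted (x ∷ xs) (y ∷ ys) sxys@(x<xs ∷ sxs) syys@(y<ys ∷ sys) =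
    sorted (unionView x y xs ys)
      (union-sorted xs (y ∷ ys) sxs syys) (union-sorted xs ys sxs sys) (union-sorted (x ∷ xs) ys sxys sys)
    where
    sorted : ∀ {τ} → UnionView x y xs ys τ → Sorted (union xs (y ∷ ys)) → Sorted (union xs ys) →
             Sorted (union (x ∷ xs) ys) → Sorted τ
    sorted (union< x<y)  s _ _ = All-union x<xs (x<y ∷ All.map (<-trans x<y) y<ys) ∷ s
    sorted (union≡ refl) _ s _ = All-union x<xs y<ys ∷ s
    sorted (union> y<x)  _ _ s = All-union (y<x ∷ All.map (<-trans y<x) x<xs) y<ys ∷ s

  union-∷ʳ : ∀ (π : Simplex n) {a x} → a F.< x → union (π ∷ʳ a) (π ∷ʳ x) ≡ π ∷ʳ a ∷ʳ x
  union-∷ʳ []      a<x rewrite <⇒<V a<x = refl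
  union-∷ʳ (y ∷ π) a<x rewrite <V-irrefl y | =V-refl y = cong (y ∷_) (union-∷ʳ π a<x)

  sorted-∷ʳ∷ʳ⁻ : ∀ (π : Simplex n) {a x} → Sorted (π ∷ʳ a ∷ʳ x) → Sorted π × All (F._< a) π × a F.< x
  sorted-∷ʳ∷ʳ⁻ π sorted =
    let sorted-πa , πa<x = AllPairs-∷ʳ⁻ sorted
        sorted-π , π<a   = AllPairs-∷ʳ⁻ sorted-πa
    in sorted-π , π<a , proj₂ (All.∷ʳ⁻ πa<x)

  lexLt-∷ʳ : ∀ (π : Simplex n) {a x} → a F.< x → lexLt (π ∷ʳ a) (π ∷ʳ x) ≡ true
  lexLt-∷ʳ []      a<x rewrite <⇒<V a<x = refl
  lexLt-∷ʳ (y ∷ π) a<x rewrite <V-irrefl y | =V-refl y = lexLt-∷ʳ π a<x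

  diff-∷ʳ-left : ∀ (π : Simplex n) {a x} → x ∉ π ∷ʳ a → diff (π ∷ʳ a ∷ʳ x) (π ∷ʳ a) ≡ x ∷ []
  diff-∷ʳ-left π {a} {x} x∉ = begin
    diff (π ∷ʳ a ∷ʳ x) (π ∷ʳ a)                        ≡⟨ diff-++ (π ∷ʳ a) (x ∷ []) (π ∷ʳ a) ⟩
    diff (π ∷ʳ a) (π ∷ʳ a) ++ diff (x ∷ []) (π ∷ʳ a)   ≡⟨ cong₂ _++_ (diff-⊆ {π ∷ʳ a} ⊆-refl) (diff-[∉] x∉) ⟩
    x ∷ []                                              ∎

  diff-∷ʳ-right : ∀ (π : Simplex n) {a x} → a ∉ π ∷ʳ x → diff (π ∷ʳ a ∷ʳ x) (π ∷ʳ x) ≡ a ∷ []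
  diff-∷ʳ-right π {a} {x} a∉ = begin
    diff (π ∷ʳ a ∷ʳ x) (π ∷ʳ x)                                         ≡⟨ diff-++ (π ∷ʳ a) (x ∷ []) (π ∷ʳ x) ⟩
    diff (π ∷ʳ a) (π ∷ʳ x) ++ diff (x ∷ []) (π ∷ʳ x)                    ≡⟨ cong (_++ _) (diff-++ π (a ∷ []) (π ∷ʳ x)) ⟩
    (diff π (π ∷ʳ x) ++ diff (a ∷ []) (π ∷ʳ x)) ++ diff (x ∷ []) (π ∷ʳ x) ≡⟨ cong₂ _++_ (cong₂ _++_ π-gone (diff-[∉] a∉)) x-gone ⟩
    a ∷ []                                                               ∎
    where
    π-gone : diff π (π ∷ʳ x) ≡ []
    π-gone = diff-⊆ (xs⊆xs++ys π (x ∷ []))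
    x-gone : diff (x ∷ []) (π ∷ʳ x) ≡ []
    x-gone = diff-⊆ λ { (here refl) → ∈-++⁺ʳ π (here refl) }

module _ {n : ℕ} (G : Graph n) where

  PairwiseAdjacent : Simplex n → Set
  PairwiseAdjacent σ = ∀ {u v} → u ∈ σ → v ∈ σ → u ≢ v → Adj G u v

  edgeCheck-intro : ∀ σ₀ σ₁ {v₀ v₁} →
    diff (union σ₀ σ₁) σ₀ ≡ v₀ ∷ [] → diff (union σ₀ σ₁) σ₁ ≡ v₁ ∷ [] → Adj G v₀ v₁ →
    edgeCheck G σ₀ σ₁ ≡ true
  edgeCheck-intro σ₀ σ₁ {v₀} {v₁} e₀ e₁ v₀~v₁ rewrite e₀ | e₁ = dec-true (adj? G v₀ v₁) v₀~v₁

  edgeCheck-elim : ∀ σ₀ σ₁ → edgeCheck G σ₀ σ₁ ≡ true →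
    ∃[ v₀ ] ∃[ v₁ ] diff (union σ₀ σ₁) σ₀ ≡ v₀ ∷ [] × diff (union σ₀ σ₁) σ₁ ≡ v₁ ∷ [] × Adj G v₀ v₁
  edgeCheck-elim σ₀ σ₁ _ with diff (union σ₀ σ₁) σ₀ | diff (union σ₀ σ₁) σ₁
  ... | v₀ ∷ [] | v₁ ∷ [] with adj? G v₀ v₁
  ...   | yes v₀~v₁ = v₀ , v₁ , refl , refl , v₀~v₁

  edgeCheck-∷ʳ : ∀ (π : Simplex n) {a x} → All (F._< a) π → a F.< x → Adj G x a →
    edgeCheck G (π ∷ʳ a) (π ∷ʳ x) ≡ true
  edgeCheck-∷ʳ π {a} {x} π<a a<x x~a = edgeCheck-intro (π ∷ʳ a) (π ∷ʳ x)
    (≡.trans (cong (λ τ → diff τ (π ∷ʳ a)) (union-∷ʳ π a<x)) (diff-∷ʳ-left π x∉πa))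
    (≡.trans (cong (λ τ → diff τ (π ∷ʳ x)) (union-∷ʳ π a<x)) (diff-∷ʳ-right π a∉πx))
    x~a
    where
    x∉πa : x ∉ π ∷ʳ a
    x∉πa = All¬⇒¬Any (All.∷ʳ⁺ (All.map (λ z<a → <⇒≢ (<-trans z<a a<x) ∘ ≡.sym) π<a) (<⇒≢ a<x ∘ ≡.sym))
    a∉πx : a ∉ π ∷ʳ x
    a∉πx = All¬⇒¬Any (All.∷ʳ⁺ (All.map (λ z<a → <⇒≢ z<a ∘ ≡.sym) π<a) (<⇒≢ a<x))

  -- The only pair of σ₀ ∪ σ₁ lying neither in σ₀ nor in σ₁ is {v₁ , v₀}.
  union-pairwiseAdjacent : ∀ {σ₀ σ₁ v₀ v₁} → PairwiseAdjacent σ₀ → PairwiseAdjacent σ₁ →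
    σ₁ ⊆ v₀ ∷ σ₀ → σ₀ ⊆ v₁ ∷ σ₁ → Adj G v₀ v₁ → PairwiseAdjacent (union σ₀ σ₁)
  union-pairwiseAdjacent {σ₀} {σ₁} adj₀ adj₁ σ₁⊆ σ₀⊆ v₀~v₁ u∈ v∈ =
    adjacent (∈-union⁻ σ₀ σ₁ u∈) (∈-union⁻ σ₀ σ₁ v∈)
    where
    across : ∀ {u v} → u ∈ σ₀ → v ∈ σ₁ → u ≢ v → Adj G u v
    across u∈₀ v∈₁ u≢v with σ₁⊆ v∈₁ | σ₀⊆ u∈₀
    ... | there v∈₀ | _         = adj₀ u∈₀ v∈₀ u≢v
    ... | here _    | there u∈₁ = adj₁ u∈₁ v∈₁ u≢v
    ... | here refl | here refl = sym G v₀~v₁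
    adjacent : ∀ {u v} → u ∈ σ₀ ⊎ u ∈ σ₁ → v ∈ σ₀ ⊎ v ∈ σ₁ → u ≢ v → Adj G u v
    adjacent (inj₁ u∈₀) (inj₁ v∈₀) u≢v = adj₀ u∈₀ v∈₀ u≢v
    adjacent (inj₂ u∈₁) (inj₂ v∈₁) u≢v = adj₁ u∈₁ v∈₁ u≢v
    adjacent (inj₁ u∈₀) (inj₂ v∈₁) u≢v = across u∈₀ v∈₁ u≢v
    adjacent (inj₂ u∈₁) (inj₁ v∈₀) u≢v = sym G (across v∈₀ u∈₁ (u≢v ∘ ≡.sym))

  union-clique : ∀ {σ₀ σ₁} → IsCliqueSimplex G σ₀ → IsCliqueSimplex G σ₁ → edgeCheck G σ₀ σ₁ ≡ true →
    IsCliqueSimplex G (union σ₀ σ₁)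
  union-clique {[]}     {σ₁} (σ₀≢[] , _) _ _ = ⊥-elim (σ₀≢[] refl)
  union-clique {x ∷ σ₀} {σ₁} (_ , sorted₀ , adj₀) (_ , sorted₁ , adj₁) check
    with edgeCheck-elim (x ∷ σ₀) σ₁ check
  ... | v₀ , v₁ , e₀ , e₁ , v₀~v₁ = nonempty , sorted , adjacent
    where
    nonempty : union (x ∷ σ₀) σ₁ ≢ []
    nonempty eq with subst (x ∈_) eq (∈-union⁺ˡ (x ∷ σ₀) σ₁ (here refl))
    ... | ()
    sorted : Linked F._<_ (union (x ∷ σ₀) σ₁)
    sorted = AllPairs⇒Linked (union-sorted (x ∷ σ₀) σ₁ (Linked⇒AllPairs <-trans sorted₀) (Linked⇒AllPairs <-trans sorted₁))
    adjacent : PairwiseAdjacent (union (x ∷ σ₀) σ₁)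
    adjacent = union-pairwiseAdjacent adj₀ adj₁
      (diff≡[v]⇒⊆ e₀ ∘ ∈-union⁺ʳ (x ∷ σ₀) σ₁) (diff≡[v]⇒⊆ e₁ ∘ ∈-union⁺ˡ (x ∷ σ₀) σ₁) v₀~v₁

  face-clique : ∀ {σ τ} → τ ⊆ σ → τ ≢ [] → Sorted τ → IsCliqueSimplex G σ → IsCliqueSimplex G τ
  face-clique τ⊆σ τ≢[] sorted (_ , _ , adj) = τ≢[] , AllPairs⇒Linked sorted , λ u∈ v∈ → adj (τ⊆σ u∈) (τ⊆σ v∈)

  vertex-clique : ∀ v → IsCliqueSimplex G (v ∷ [])
  vertex-clique v = (λ ()) , [-] , λ { (here refl) (here refl) v≢v → ⊥-elim (v≢v refl) }

  edge-clique : ∀ {u v} → u F.< v → Adj G u v → IsCliqueSimplex G (u ∷ v ∷ [])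
  edge-clique u<v u~v = (λ ()) , u<v ∷ [-] , adjacent
    where
    adjacent : PairwiseAdjacent _
    adjacent (here refl)         (here refl)         ne = ⊥-elim (ne refl)
    adjacent (here refl)         (there (here refl)) _  = u~v
    adjacent (there (here refl)) (here refl)         _  = sym G u~v
    adjacent (there (here refl)) (there (here refl)) ne = ⊥-elim (ne refl)

  PNode⇒clique : ∀ {k σ ρ} → PNode G k σ ρ → IsCliqueSimplex G σ
  PNode⇒clique (vertex v)               = vertex-clique v
  PNode⇒clique (edge u v u<v u~v)       = edge-clique (<V⇒< u<v) u~v
  PNode⇒clique (join _ p₀ p₁ _ check)   = union-clique (PNode⇒clique p₀) (PNode⇒clique p₁) check

  depth : ∀ {ρ : Simplex n} → Reverse ρ → ℕ
  depth []             = 0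
  depth (_ ∶ rπ ∶ʳ _) = suc (depth rπ)

  -- The level is counted along the view rather than as `length ρ`, so that the
  -- recursive calls of the last clause land at the levels `join` expects.
  clique⇒PNode : ∀ {ρ} (rρ : Reverse ρ) x → IsCliqueSimplex G (ρ ∷ʳ x) → PNode G (depth rρ) (ρ ∷ʳ x) ρ
  clique⇒PNode []            x _ = vertex x
  clique⇒PNode (_ ∶ [] ∶ʳ u) x (_ , u<x ∷ [-] , adjacent) =
    edge u x (<⇒<V u<x) (adjacent (here refl) (there (here refl)) (<⇒≢ u<x))
  clique⇒PNode (π ∶ rπ@(π′ ∶ rπ′ ∶ʳ c) ∶ʳ a) x cl@(_ , sorted , adjacent) =
    let sorted-π , π<a , a<x = sorted-∷ʳ∷ʳ⁻ π (Linked⇒AllPairs <-trans sorted)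
        π<x = All.map (λ z<a → <-trans z<a a<x) π<a
    in
    subst (λ τ → PNode G _ τ (π ∷ʳ a)) (union-∷ʳ π a<x)
      (join (clique⇒PNode rπ′ c (face-clique π⊆ (∷ʳ≢[] π′) sorted-π cl))
            (clique⇒PNode rπ a (face-clique πa⊆ (∷ʳ≢[] π) (AllPairs-∷ʳ⁺ sorted-π π<a) cl))
            (clique⇒PNode rπ x (face-clique πx⊆ (∷ʳ≢[] π) (AllPairs-∷ʳ⁺ sorted-π π<x) cl))
            (lexLt-∷ʳ π a<x)
            (edgeCheck-∷ʳ π π<a a<x (adjacent x∈ a∈ (<⇒≢ a<x ∘ ≡.sym))))
    where
    x∈ : x ∈ π ∷ʳ a ∷ʳ x
    x∈ = ∈-++⁺ʳ (π ∷ʳ a) (here refl)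
    a∈ : a ∈ π ∷ʳ a ∷ʳ x
    a∈ = ∈-++⁺ˡ (∈-++⁺ʳ π (here refl))
    πa⊆ : π ∷ʳ a ⊆ π ∷ʳ a ∷ʳ x
    πa⊆ = xs⊆xs++ys (π ∷ʳ a) (x ∷ [])
    π⊆ : π ⊆ π ∷ʳ a ∷ʳ x
    π⊆ = ⊆-trans (xs⊆xs++ys π (a ∷ [])) πa⊆
    πx⊆ : π ∷ʳ x ⊆ π ∷ʳ a ∷ʳ x
    πx⊆ = ++⁺ (xs⊆xs++ys π (a ∷ [])) ⊆-refl

  clique⇒∃PNode : ∀ {σ} → IsCliqueSimplex G σ → ∃[ k ] ∃[ ρ ] PNode G k σ ρ
  clique⇒∃PNode {σ} cl with reverseView σ
  ... | []          = ⊥-elim (proj₁ cl refl)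
  ... | ρ ∶ rρ ∶ʳ x = depth rρ , ρ , clique⇒PNode rρ x cl

  parallel⇔clique : ∀ σ → (∃[ k ] ∃[ ρ ] PNode G k σ ρ) ⇔ IsCliqueSimplex G σ
  parallel⇔clique σ = mk⇔ (λ (_ , _ , p) → PNode⇒clique p) clique⇒∃PNode

  children : List (Node n) → Simplex n → List (Simplex n)
  children B ρ = map proj₁ (filterᵇ (λ s → proj₂ s =S ρ) B)

  ∈-children⁺ : ∀ {B σ ρ} → (σ , ρ) ∈ B → σ ∈ children B ρ
  ∈-children⁺ {ρ = ρ} σρ∈ =
    ∈-map⁺ proj₁ (∈-filter⁺ (λ s → T? (proj₂ s =S ρ)) σρ∈ (T-does⁺ (≡-dec F._≟_ ρ ρ) refl))

  ∈-children⁻ : ∀ {B σ ρ} → σ ∈ children B ρ → (σ , ρ) ∈ B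
  ∈-children⁻ {B} {ρ = ρ} σ∈ with ∈-map⁻ proj₁ σ∈
  ... | (σ , ρ′) , σρ′∈ , refl with ∈-filter⁻ (λ s → T? (proj₂ s =S ρ)) {xs = B} σρ′∈
  ...   | σρ′∈B , ρ′=ρ = subst (λ q → (σ , q) ∈ B) (T-does⁻ (≡-dec F._≟_ ρ′ ρ) ρ′=ρ) σρ′∈B

  data StepNode (A B : List (Node n)) : Node n → Set where
    joined : ∀ {ρ ρ′ σ₀ σ₁} → (ρ , ρ′) ∈ A → (σ₀ , ρ) ∈ B → (σ₁ , ρ) ∈ B →
             lexLt σ₀ σ₁ ≡ true → edgeCheck G σ₀ σ₁ ≡ true → StepNode A B (union σ₀ σ₁ , σ₀)

  ∈-step⁺ : ∀ {A B ν} → StepNode A B ν → ν ∈ step G A B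
  ∈-step⁺ (joined {σ₀ = σ₀} {σ₁} ρ∈ σ₀∈ σ₁∈ lt check) =
    ∈-concatMap⁺ _ (lose ρ∈ (∈-concatMap⁺ _ (lose (∈-children⁺ σ₀∈)
      (∈-concatMap⁺ _ (lose (∈-children⁺ σ₁∈) (∈-if⁺ (Equivalence.from T-∧-≡ (lt , check))))))))

  ∈-step⁻ : ∀ {A B ν} → ν ∈ step G A B → StepNode A B ν
  ∈-step⁻ {A} {B} ν∈ with find (∈-concatMap⁻ _ {xs = A} ν∈)
  ... | (ρ , _) , ρ∈ , ν∈′ with find (∈-concatMap⁻ _ {xs = children B ρ} ν∈′)
  ... | σ₀ , σ₀∈ , ν∈″ with find (∈-concatMap⁻ _ {xs = children B ρ} ν∈″)
  ... | σ₁ , σ₁∈ , ν∈‴ with ∈-if⁻ (lexLt σ₀ σ₁ ∧ edgeCheck G σ₀ σ₁) ν∈‴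
  ... | both , refl =
    let lt , check = Equivalence.to T-∧-≡ both in joined ρ∈ (∈-children⁻ σ₀∈) (∈-children⁻ σ₁∈) lt check

  ∈-D1⁺ : ∀ {σ ρ} → PNode G 1 σ ρ → (σ , ρ) ∈ D1 G
  ∈-D1⁺ (edge u v u<v u~v) =
    ∈-concatMap⁺ _ (lose (∈-allFin u) (∈-concatMap⁺ _ (lose (∈-allFin v)
      (∈-if⁺ (Equivalence.from T-∧-≡ (u<v , dec-true (adj? G u v) u~v))))))

  ∈-D1⁻ : ∀ {σ ρ} → (σ , ρ) ∈ D1 G → PNode G 1 σ ρ
  ∈-D1⁻ σρ∈ with satisfied (∈-concatMap⁻ _ {xs = allFin n} σρ∈)
  ... | u , σρ∈′ with satisfied (∈-concatMap⁻ _ {xs = allFin n} σρ∈′)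
  ... | v , σρ∈″ with ∈-if⁻ ((u <V v) ∧ does (adj? G u v)) σρ∈″
  ... | both , refl =
    let u<v , u~v = Equivalence.to T-∧-≡ both in edge u v u<v (T-does⁻ (adj? G u v) (Equivalence.from T-≡ u~v))

  PNode⇒D : ∀ {k σ ρ} → PNode G k σ ρ → (σ , ρ) ∈ D G k
  PNode⇒D (vertex v)                 = ∈-map⁺ _ (∈-allFin v)
  PNode⇒D p@(edge _ _ _ _)           = ∈-D1⁺ p
  PNode⇒D (join pρ p₀ p₁ lt check)   = ∈-step⁺ (joined (PNode⇒D pρ) (PNode⇒D p₀) (PNode⇒D p₁) lt check)

  StepNode⇒PNode : ∀ {k A B ν} →
    (∀ {σ ρ} → (σ , ρ) ∈ A → PNode G k σ ρ) → (∀ {σ ρ} → (σ , ρ) ∈ B → PNode G (suc k) σ ρ) →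
    StepNode A B ν → PNode G (suc (suc k)) (proj₁ ν) (proj₂ ν)
  StepNode⇒PNode A⇒ B⇒ (joined ρ∈ σ₀∈ σ₁∈ lt check) = join (A⇒ ρ∈) (B⇒ σ₀∈) (B⇒ σ₁∈) lt check

  D⇒PNode : ∀ k {σ ρ} → (σ , ρ) ∈ D G k → PNode G k σ ρ
  D⇒PNode zero          σρ∈ with ∈-map⁻ _ σρ∈
  ... | v , _ , refl = vertex v
  D⇒PNode (suc zero)    σρ∈ = ∈-D1⁻ σρ∈
  D⇒PNode (suc (suc k)) σρ∈ = StepNode⇒PNode (D⇒PNode k) (D⇒PNode (suc k)) (∈-step⁻ σρ∈)

  serial⇔parallel : ∀ σ → (∃[ k ] σ ∈ map proj₁ (D G k)) ⇔ (∃[ k ] ∃[ ρ ] PNode G k σ ρ)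
  serial⇔parallel σ = mk⇔ serial⇒parallel (λ (k , _ , p) → k , ∈-map⁺ proj₁ (PNode⇒D p))
    where
    serial⇒parallel : (∃[ k ] σ ∈ map proj₁ (D G k)) → ∃[ k ] ∃[ ρ ] PNode G k σ ρ
    serial⇒parallel (k , σ∈) with ∈-map⁻ proj₁ σ∈
    ... | (_ , ρ) , σρ∈ , refl = k , ρ , D⇒PNode k σρ∈

theorem3p3 : ∀ {n} (G : Graph n) →
    (∀ σ → (∃[ k ] σ ∈ map proj₁ (D G k)) ⇔ IsCliqueSimplex G σ)
    × (∀ σ → (∃[ k ] ∃[ ρ ] PNode G k σ ρ) ⇔ IsCliqueSimplex G σ)
theorem3p3 G = (λ σ → ⇔.trans (serial⇔parallel G σ) (parallel⇔clique G σ)) , parallel⇔clique G
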